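{- Let $0<\kappa<\sigma<\tfrac13$. Then for even $N\geqslant 4$, $$D_{1,2}(N)\geqslant S(\mathcal A;\mathcal P(N),N^\kappa)-\tfrac12S_1-S_2-\tfrac12S_3+\tfrac12S_4+O(N^{1-\kappa}),$$ where (all $p,p_i$ primes) $S_1:=\sum_{N^\kappa\leqslant p<N^\sigma,\,(p,N)=1}S(\mathcal A_p;\mathcal P(N),N^\kappa)$, $S_2:=\sum_{N^\sigma\leqslant p_1<p_2<(N/p_1)^{1/2},\,(p_1p_2,N)=1}S(\mathcal A_{p_1p_2};\mathcal P(Np_1),p_2)$, $S_3:=\sum_{N^\kappa\leqslant p_1<N^\sigma\leqslant p_2<(N/p_1)^{1/2},\,(p_1p_2,N)=1}S(\mathcal A_{p_1p_2};\mathcal P(Np_1),p_2)$, $S_4:=\sum_{N^\kappa\leqslant p_1<p_2<p_3<N^\sigma,\,(p_1p_2p_3,N)=1}S(\mathcal A_{p_1p_2p_3};\mathcal P(Np_1),p_2)$.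
   Context: $\Omega(n)$ is the number of prime factors of $n$ counted with multiplicity; $D_{1,2}(N):=|\{p\leqslant N: p\text{ prime},\ \Omega(N-p)\leqslant2\}|$. $\mathcal A$ is the multiset $\{N-p: p\leqslant N,\ p\text{ prime}\}$, $\mathcal A_d:=\{a\in\mathcal A:d\mid a\}$, $\mathcal P(q)$ is the set of primes not dividing $q$, and for a set of primes $\mathcal P$ and $z\geqslant2$, $S(\mathcal A_d;\mathcal P,z):=|\{a\in\mathcal A_d:(a,\prod_{p<z,\,p\in\mathcal P}p)=1\}|$ (with multiplicity). -}

module Defs where

open import Data.Nat using (ℕ; zero; suc; _+_; _*_; _∸_; _^_; _≤_; _<_)
open import Data.Nat.Divisibility using (_∣_)
open import Data.Nat.Primality using (Prime)
open import Data.Nat.Coprimality using (Coprime)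
open import Data.Integer using (ℤ; +_; -[1+_])
open import Data.Rational using (ℚ)
import Data.Rational as ℚ
open import Data.Product using (Σ; ∃; _×_; _,_)
open import Data.Sum using (_⊎_)
open import Data.List using (List; length)
open import Data.List.Membership.Propositional using (_∈_)
open import Data.List.Relation.Unary.Unique.Propositional using (Unique)
open import Function.Bundles using (_⇔_)
open import Relation.Nullary using (¬_)
open import Relation.Binary.PropositionalEquality using (_≡_)

-- Real numbers, as (classical) lower Dedekind cuts of ℚ.
-- A real x is represented by L x = { q ∈ ℚ : q < x }.

record Real : Set₁ where
  field
    L         : ℚ → Set
    inhabited : ∃ λ q → L q
    bounded   : ∃ λ q → ¬ L q
    downward  : ∀ {p q} → p ℚ.< q → L q → L p
    rounded   : ∀ {q} → L q → ∃ λ r → q ℚ.< r × L r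
open Real public

_<ℝ_ : Real → Real → Set
x <ℝ y = ∃ λ q → ¬ L x q × L y q          -- x ≤ q < y

_<ℚℝ_ : ℚ → Real → Set
q <ℚℝ x = L x q

_<ℝℚ_ : Real → ℚ → Set
x <ℝℚ q = ∃ λ r → ¬ L x r × r ℚ.< q        -- x ≤ r < q

-- Comparisons involving rational powers  N ^ r  (r = a / b, b ≥ 1),
-- cleared of roots by raising to the b-th power.

-- X · N^(n/b) < Y
private
  mulPowLt : ℕ → ℕ → ℤ → ℕ → ℕ → Set
  mulPowLt X N (+ a)      b Y = X ^ b * N ^ a < Y ^ b
  mulPowLt X N -[1+ m ]   b Y = X ^ b < Y ^ b * N ^ suc m

  -- x < N^(n/b)
  ltPow : ℕ → ℕ → ℤ → ℕ → Set
  ltPow x N (+ a)    b = x ^ b < N ^ a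
  ltPow x N -[1+ m ] b = x ^ b * N ^ suc m < 1

MulPowLt : ℕ → ℕ → ℚ → ℕ → Set
MulPowLt X N r Y = mulPowLt X N (ℚ.numerator r) (ℚ.denominatorℕ r) Y

LtPowℚ : ℕ → ℕ → ℚ → Set
LtPowℚ x N r = ltPow x N (ℚ.numerator r) (ℚ.denominatorℕ r)

-- N^κ ≤ x   (κ real):  N^r < x for every rational r < κ
PowLe : ℕ → Real → ℕ → Set
PowLe N κ x = ∀ r → L κ r → MulPowLt 1 N r x

-- x < N^κ   (κ real):  x < N^r for some rational r < κ
LtPow : ℕ → ℕ → Real → Set
LtPow x N κ = ∃ λ r → L κ r × LtPowℚ x N r

-- X ≤ C · N^(1-κ)  ⇔  X · N^κ ≤ C · N
--                  ⇔  X = 0  or  X · N^r < C · N for every rational r < κ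
LeMulPow1- : ℕ → ℕ → ℕ → Real → Set
LeMulPow1- X C N κ = X ≡ 0 ⊎ (∀ r → L κ r → MulPowLt X N r (C * N))

HasCard : {A : Set} → (A → Set) → ℕ → Set
HasCard {A} P n =
  Σ (List A) λ xs → Unique xs × (∀ x → P x ⇔ x ∈ xs) × length xs ≡ n

data Ω : ℕ → ℕ → Set where
  Ω-one  : Ω 1 0
  Ω-step : ∀ {p m k} → Prime p → Ω m k → Ω (p * m) (suc k)

D12Set : ℕ → ℕ → Set
D12Set N p = Prime p × p ≤ N × ∃ λ k → Ω (N ∸ p) k × k ≤ 2

-- Elements of 𝒜 = {N - p : p ≤ N prime} are indexed by the prime p.
-- SiftSet N d q Below p  :  N - p ∈ 𝒜_d and N - p is coprime to every
-- prime ℓ ∈ 𝒫(q) with "ℓ < z" (expressed by the predicate Below).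
-- Its cardinality is S(𝒜_d; 𝒫(q), z).
SiftSet : ℕ → ℕ → ℕ → (ℕ → Set) → ℕ → Set
SiftSet N d q Below p =
  Prime p × p ≤ N × d ∣ (N ∸ p) ×
  (∀ ℓ → Prime ℓ → Below ℓ → ¬ (ℓ ∣ q) → ¬ (ℓ ∣ (N ∸ p)))

S0Set : ℕ → Real → ℕ → Set
S0Set N κ = SiftSet N 1 N (λ ℓ → LtPow ℓ N κ)

S1Set : ℕ → Real → Real → ℕ × ℕ → Set
S1Set N κ σ (p , a) =
  Prime p × PowLe N κ p × LtPow p N σ × Coprime p N ×
  SiftSet N p N (λ ℓ → LtPow ℓ N κ) a

-- S₂ : N^σ ≤ p₁ < p₂ < (N/p₁)^(1/2)   (the last ⇔ p₂² p₁ < N)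
S2Set : ℕ → Real → Real → ℕ × ℕ × ℕ → Set
S2Set N κ σ (p₁ , p₂ , a) =
  Prime p₁ × Prime p₂ × PowLe N σ p₁ × p₁ < p₂ × p₂ * p₂ * p₁ < N ×
  Coprime (p₁ * p₂) N ×
  SiftSet N (p₁ * p₂) (N * p₁) (λ ℓ → ℓ < p₂) a

S3Set : ℕ → Real → Real → ℕ × ℕ × ℕ → Set
S3Set N κ σ (p₁ , p₂ , a) =
  Prime p₁ × Prime p₂ × PowLe N κ p₁ × LtPow p₁ N σ × PowLe N σ p₂ ×
  p₂ * p₂ * p₁ < N × Coprime (p₁ * p₂) N ×
  SiftSet N (p₁ * p₂) (N * p₁) (λ ℓ → ℓ < p₂) a

S4Set : ℕ → Real → Real → ℕ × ℕ × ℕ × ℕ → Set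
S4Set N κ σ (p₁ , p₂ , p₃ , a) =
  Prime p₁ × Prime p₂ × Prime p₃ × PowLe N κ p₁ × p₁ < p₂ × p₂ < p₃ ×
  LtPow p₃ N σ × Coprime (p₁ * p₂ * p₃) N ×
  SiftSet N (p₁ * p₂ * p₃) (N * p₁) (λ ℓ → ℓ < p₂) a

{-# OPTIONS --safe #-}
-- Chen's weighted inequality, checked pointwise. Index the elements N − q of 𝒜 by the prime q and
-- split each of D, S₀, …, S₄ into its fibres over q. For every q,
--   2·[q ∈ S₀] + #S₄(q) ≤ 2·#D(q) + #S₁(q) + 2·#S₂(q) + #S₃(q) + 2·e(q),
-- where e(q) > 0 only if q ∣ N or ℓ² ∣ N − q for some ℓ ≥ N^r, with r < κ rational.
-- If S₄(q) ≠ ∅, the sieve condition determines its first two primes p₁ < p₂, so (p₁, q), (p₂, q) and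
-- every (p₃, q) lie in S₁. Otherwise, if q ∈ S₀ is not exceptional, N − q is coprime to N and free of
-- prime factors below N^κ: either Ω(N − q) ≤ 2, or its two least prime factors q₁ < q₂ satisfy
-- q₂²q₁ < N, and their position relative to N^σ puts q twice into S₁, into S₁ and S₃, or into S₂.
-- Summed over q, the exceptional weights are O(log N + N/N^r) = O(N^(1−r)).

module Submission where

open import Defs
open import Data.Nat hiding (_/_)
open import Data.Nat.Properties
open import Data.Nat.Divisibility
open import Data.Nat.Primality
open import Data.Nat.Coprimality using (Coprime)
open import Data.Nat.Solver using (module +-*-Solver)
open import Data.Integer as ℤ using (+_; -[1+_])
import Data.Integer.Properties as ℤ
open import Data.Rational as ℚ using (mkℚ; _/_; 0ℚ)
import Data.Rational.Properties as ℚ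
open import Data.Fin using (zero; suc)
open import Data.Fin.Properties using (injective⇒≤)
open import Data.List using (List; []; _∷_; length; filter; map; lookup)
open import Data.List.Properties using (length-map; filter-accept; filter-reject)
open import Data.List.Membership.Propositional using (_∈_)
open import Data.List.Membership.Propositional.Properties
  using (∈-lookup; ∈-filter⁺; ∈-filter⁻; ∈-map⁻)
open import Data.List.Membership.Setoid.Properties using (index-injective)
open import Data.List.Relation.Binary.Subset.Propositional using (_⊆_)
open import Data.List.Relation.Unary.Any using (here; there)
open import Data.List.Relation.Unary.All as All using (All; []; _∷_)
open import Data.List.Relation.Unary.AllPairs using ([]; _∷_)
open import Data.List.Relation.Unary.Unique.Propositional using (Unique)
import Data.List.Relation.Unary.Unique.Propositional.Properties as Unique
open import Data.Product using (∃; ∃-syntax; _×_; _,_; proj₁; proj₂)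
open import Data.Sum using (_⊎_; inj₁; inj₂; [_,_]′; map₂)
open import Function.Base using (_∘_; id)
open import Function.Bundles using (module Equivalence)
open import Relation.Nullary
open import Relation.Nullary.Decidable using (_×-dec_; decidable-stable; ¬¬-excluded-middle)
open import Relation.Unary using (Decidable)
open import Relation.Binary.Definitions using (tri<; tri≈; tri>)
open import Relation.Binary.PropositionalEquality
open import Algebra.Properties.CommutativeSemigroup +-commutativeSemigroup
  using (interchange)

∑< : ℕ → (ℕ → ℕ) → ℕ
∑< zero    f = 0
∑< (suc n) f = ∑< n f + f n

syntax ∑< n (λ i → e) = ∑[ i < n ] e

module _ {f g : ℕ → ℕ} where

  ∑-cong : ∀ n → (∀ i → f i ≡ g i) → ∑[ i < n ] f i ≡ ∑[ i < n ] g i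
  ∑-cong zero    f≗g = refl
  ∑-cong (suc n) f≗g = cong₂ _+_ (∑-cong n f≗g) (f≗g n)

  ∑-mono-≤ : ∀ n → (∀ i → i < n → f i ≤ g i) → ∑[ i < n ] f i ≤ ∑[ i < n ] g i
  ∑-mono-≤ zero    f≤g = z≤n
  ∑-mono-≤ (suc n) f≤g =
    +-mono-≤ (∑-mono-≤ n (λ i i<n → f≤g i (m<n⇒m<1+n i<n))) (f≤g n ≤-refl)

  ∑-distrib-+ : ∀ n → ∑[ i < n ] (f i + g i) ≡ ∑[ i < n ] f i + ∑[ i < n ] g i
  ∑-distrib-+ zero    = refl
  ∑-distrib-+ (suc n) = begin
    ∑[ i < n ] (f i + g i) + (f n + g n)          ≡⟨ cong (_+ (f n + g n)) (∑-distrib-+ n) ⟩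
    (∑[ i < n ] f i + ∑[ i < n ] g i) + (f n + g n) ≡⟨ interchange (∑[ i < n ] f i) (∑[ i < n ] g i) (f n) (g n) ⟩
    (∑[ i < n ] f i + f n) + (∑[ i < n ] g i + g n) ∎
    where open ≡-Reasoning

∑-distribˡ-* : ∀ c (f : ℕ → ℕ) n → ∑[ i < n ] (c * f i) ≡ c * ∑[ i < n ] f i
∑-distribˡ-* c f zero    = sym (*-zeroʳ c)
∑-distribˡ-* c f (suc n) =
  trans (cong (_+ c * f n) (∑-distribˡ-* c f n)) (sym (*-distribˡ-+ c _ (f n)))

∑-const : ∀ c n → ∑[ i < n ] c ≡ n * c
∑-const c zero    = refl
∑-const c (suc n) = trans (cong (_+ c) (∑-const c n)) (+-comm (n * c) c)

∑-split-head : ∀ (f : ℕ → ℕ) n → ∑[ i < suc n ] f i ≡ f 0 + ∑[ i < n ] f (suc i)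
∑-split-head f zero    = +-comm 0 (f 0)
∑-split-head f (suc n) = trans (cong (_+ f (suc n)) (∑-split-head f n)) (+-assoc (f 0) _ _)

∑-reverse : ∀ (f : ℕ → ℕ) n → ∑[ i < suc n ] f (n ∸ i) ≡ ∑[ i < suc n ] f i
∑-reverse f zero    = refl
∑-reverse f (suc n) = begin
  ∑[ i < suc (suc n) ] f (suc n ∸ i)  ≡⟨ ∑-split-head (λ i → f (suc n ∸ i)) (suc n) ⟩
  f (suc n) + ∑[ i < suc n ] f (n ∸ i) ≡⟨ cong (λ m → f (suc n) + m) (∑-reverse f n) ⟩
  f (suc n) + ∑[ i < suc n ] f i      ≡⟨ +-comm (f (suc n)) _ ⟩
  ∑[ i < suc (suc n) ] f i            ∎
  where open ≡-Reasoning

∑-comm : ∀ (h : ℕ → ℕ → ℕ) m n → ∑[ i < m ] ∑[ j < n ] h j i ≡ ∑[ j < n ] ∑[ i < m ] h j i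
∑-comm h zero    n = sym (trans (∑-const 0 n) (*-zeroʳ n))
∑-comm h (suc m) n = trans (cong (_+ ∑[ j < n ] h j m) (∑-comm h m n)) (sym (∑-distrib-+ n))

indicator : ∀ {A : Set} → Dec A → ℕ
indicator (yes _) = 1
indicator (no  _) = 0

indicator≤1 : ∀ {A : Set} (d : Dec A) → indicator d ≤ 1
indicator≤1 (yes _) = ≤-refl
indicator≤1 (no  _) = z≤n

indicator≡0⇒¬ : ∀ {A : Set} (d : Dec A) → indicator d ≡ 0 → ¬ A
indicator≡0⇒¬ (no ¬a) _ = ¬a

∑-indicator-≟≡0 : ∀ {k} n → n ≤ k → ∑[ i < n ] indicator (k ≟ i) ≡ 0
∑-indicator-≟≡0         zero    _   = refl
∑-indicator-≟≡0 {k} (suc n) n<k with k ≟ n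
... | yes refl = contradiction n<k (<-irrefl refl)
... | no  _    = trans (+-identityʳ _) (∑-indicator-≟≡0 n (<⇒≤ n<k))

∑-indicator-≟≡1 : ∀ {k} n → k < n → ∑[ i < n ] indicator (k ≟ i) ≡ 1
∑-indicator-≟≡1 {k} (suc n) k<1+n with k ≟ n
... | yes refl = cong (_+ 1) (∑-indicator-≟≡0 n ≤-refl)
... | no  k≢n  = trans (+-identityʳ _) (∑-indicator-≟≡1 n (≤∧≢⇒< (s≤s⁻¹ k<1+n) k≢n))

module _ {A : Set} where

  ∈⇒length>0 : ∀ {x : A} {xs} → x ∈ xs → 0 < length xs
  ∈⇒length>0 {xs = _ ∷ _} _ = z<s

  length>0⇒∈ : ∀ {xs : List A} → 0 < length xs → ∃[ x ] x ∈ xs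
  length>0⇒∈ {x ∷ _} _ = x , here refl

  Unique-lookup-injective : ∀ {xs : List A} → Unique xs →
    ∀ {i j} → lookup xs i ≡ lookup xs j → i ≡ j
  Unique-lookup-injective (_     ∷ _) {zero}  {zero}  _  = refl
  Unique-lookup-injective (x∉xs ∷ _) {zero}  {suc j} eq = contradiction eq (All.lookup x∉xs (∈-lookup j))
  Unique-lookup-injective (x∉xs ∷ _) {suc i} {zero}  eq = contradiction (sym eq) (All.lookup x∉xs (∈-lookup i))
  Unique-lookup-injective (_     ∷ u) {suc i} {suc j} eq = cong suc (Unique-lookup-injective u eq)

  Unique⇒length≤ : ∀ {xs ys : List A} → Unique xs → xs ⊆ ys → length xs ≤ length ys
  Unique⇒length≤ u xs⊆ys = injective⇒≤ λ {i} {j} eq →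
    Unique-lookup-injective u (index-injective (setoid A) (xs⊆ys (∈-lookup i)) (xs⊆ys (∈-lookup j)) eq)

  Unique-map⁺ : ∀ {B : Set} {f : A → B} {xs} →
    (∀ {x y} → x ∈ xs → y ∈ xs → f x ≡ f y → x ≡ y) → Unique xs → Unique (map f xs)
  Unique-map⁺ _   [] = []
  Unique-map⁺ {f = f} {x ∷ xs} inj (x∉xs ∷ u) =
    All.tabulate fresh ∷ Unique-map⁺ (λ x∈ y∈ → inj (there x∈) (there y∈)) u
    where
    fresh : ∀ {z} → z ∈ map f xs → f x ≢ z
    fresh z∈ fx≡z with ∈-map⁻ f z∈
    ... | y , y∈xs , refl = All.lookup x∉xs y∈xs (inj (here refl) (there y∈xs) fx≡z)

module Fibres {A : Set} (key : A → ℕ) where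

  fibre : ℕ → List A → List A
  fibre a = filter (λ x → key x ≟ a)

  ∈-fibre⁺ : ∀ {a x xs} → x ∈ xs → key x ≡ a → x ∈ fibre a xs
  ∈-fibre⁺ = ∈-filter⁺ (λ x → key x ≟ _)

  ∈-fibre⁻ : ∀ {a x xs} → x ∈ fibre a xs → x ∈ xs × key x ≡ a
  ∈-fibre⁻ = ∈-filter⁻ (λ x → key x ≟ _)

  fibre-unique : ∀ {a xs} → Unique xs → Unique (fibre a xs)
  fibre-unique = Unique.filter⁺ (λ x → key x ≟ _)

  length-fibre-∷ : ∀ a x xs → length (fibre a (x ∷ xs)) ≡ indicator (key x ≟ a) + length (fibre a xs)
  length-fibre-∷ a x xs with key x ≟ a
  ... | yes kx≡a = cong length (filter-accept (λ x → key x ≟ a) kx≡a)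
  ... | no  kx≢a = cong length (filter-reject (λ x → key x ≟ a) kx≢a)

  length≡∑fibres : ∀ M {xs} → All (λ x → key x < M) xs → length xs ≡ ∑[ a < M ] length (fibre a xs)
  length≡∑fibres M [] = sym (trans (∑-const 0 M) (*-zeroʳ M))
  length≡∑fibres M {x ∷ xs} (kx<M ∷ keys<M) = begin
    1 + length xs
      ≡⟨ cong₂ _+_ (sym (∑-indicator-≟≡1 M kx<M)) (length≡∑fibres M keys<M) ⟩
    ∑[ a < M ] indicator (key x ≟ a) + ∑[ a < M ] length (fibre a xs)
      ≡⟨ sym (∑-distrib-+ M) ⟩
    ∑[ a < M ] (indicator (key x ≟ a) + length (fibre a xs))
      ≡⟨ ∑-cong M (λ a → sym (length-fibre-∷ a x xs)) ⟩
    ∑[ a < M ] length (fibre a (x ∷ xs)) ∎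
    where open ≡-Reasoning

length≤1 : ∀ {A : Set} {xs : List A} → Unique xs → (∀ {x y} → x ∈ xs → y ∈ xs → x ≡ y) → length xs ≤ 1
length≤1 []                 _    = z≤n
length≤1 (_ ∷ [])           _    = s≤s z≤n
length≤1 ((x≢y ∷ _) ∷ _) all≡ = contradiction (all≡ (here refl) (there (here refl))) x≢y

module Card {A : Set} {P : A → Set} {n : ℕ} (key : A → ℕ) (h : HasCard P n) where

  open Fibres key public

  elements : List A
  elements = proj₁ h

  elements-unique : Unique elements
  elements-unique = proj₁ (proj₂ h)

  ∈-elements⁺ : ∀ {x} → P x → x ∈ elements
  ∈-elements⁺ {x} = Equivalence.to (proj₁ (proj₂ (proj₂ h)) x)

  ∈-elements⁻ : ∀ {x} → x ∈ elements → P x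
  ∈-elements⁻ {x} = Equivalence.from (proj₁ (proj₂ (proj₂ h)) x)

  count : ℕ → ℕ
  count a = length (fibre a elements)

  ∈-count⁻ : ∀ {a x} → x ∈ fibre a elements → P x × key x ≡ a
  ∈-count⁻ x∈ = let x∈xs , kx≡a = ∈-fibre⁻ x∈ in ∈-elements⁻ x∈xs , kx≡a

  ∈-count⁺ : ∀ {x} → P x → x ∈ fibre (key x) elements
  ∈-count⁺ px = ∈-fibre⁺ (∈-elements⁺ px) refl

  n≡∑count : ∀ M → (∀ {x} → P x → key x < M) → n ≡ ∑[ a < M ] count a
  n≡∑count M bounded =
    trans (sym (proj₂ (proj₂ (proj₂ h)))) (length≡∑fibres M (All.tabulate (bounded ∘ ∈-elements⁻)))

  count>0 : ∀ {x} → P x → 0 < count (key x)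
  count>0 = ∈⇒length>0 ∘ ∈-count⁺

  count≥2 : ∀ {x y} → P x → P y → x ≢ y → key y ≡ key x → 2 ≤ count (key x)
  count≥2 px py x≢y ky≡kx = Unique⇒length≤ ((x≢y ∷ []) ∷ [] ∷ []) λ where
    (here refl)         → ∈-count⁺ px
    (there (here refl)) → ∈-fibre⁺ (∈-elements⁺ py) ky≡kx

  count>0⇒∃ : ∀ {a} → 0 < count a → ∃[ x ] P x × key x ≡ a
  count>0⇒∃ count>0 = let x , x∈ = length>0⇒∈ count>0 in x , ∈-count⁻ x∈

  count≤1 : (∀ {x y} → P x → P y → key x ≡ key y → x ≡ y) → ∀ a → count a ≤ 1
  count≤1 key-injective a = length≤1 (fibre-unique elements-unique) λ x∈ y∈ →
    let px , kx≡a = ∈-count⁻ x∈ ; py , ky≡a = ∈-count⁻ y∈ in key-injective px py (trans kx≡a (sym ky≡a))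

module _ {P : ℕ → Set} (P? : Decidable P) where

  minimal : ∀ {n} → P n → ∃[ m ] m ≤ n × P m × (∀ {k} → k < m → ¬ P k)
  minimal {n} pn with search n
    where
    search : ∀ n → (∃[ m ] m < n × P m × (∀ {k} → k < m → ¬ P k)) ⊎ (∀ {k} → k < n → ¬ P k)
    search zero = inj₂ λ ()
    search (suc n) with search n | P? n
    ... | inj₁ (m , m<n , pm , below) | _      = inj₁ (m , m<n⇒m<1+n m<n , pm , below)
    ... | inj₂ none                   | yes pn = inj₁ (n , ≤-refl , pn , none)
    ... | inj₂ none                   | no ¬pn = inj₂ λ k<1+n →
      [ none , (λ { refl → ¬pn }) ]′ (m<1+n⇒m<n∨m≡n k<1+n)
  ... | inj₁ (m , m<n , pm , below) = m , <⇒≤ m<n , pm , below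
  ... | inj₂ none                   = n , ≤-refl , pn , none

prime≥2 : ∀ {p} → Prime p → 2 ≤ p
prime≥2 {p} pp = nonTrivial⇒n>1 p {{prime⇒nonTrivial pp}}

prime∣prime⇒≡ : ∀ {ℓ p} → Prime ℓ → Prime p → ℓ ∣ p → ℓ ≡ p
prime∣prime⇒≡ pℓ pp ℓ∣p with prime⇒irreducible pp ℓ∣p
... | inj₁ refl = contradiction (prime≥2 pℓ) (<-irrefl refl)
... | inj₂ ℓ≡p  = ℓ≡p

prime∣m*p⇒∣m⊎≡p : ∀ {ℓ m p} → Prime ℓ → Prime p → ℓ ∣ m * p → ℓ ∣ m ⊎ ℓ ≡ p
prime∣m*p⇒∣m⊎≡p {m = m} {p} pℓ pp ℓ∣m*p = map₂ (prime∣prime⇒≡ pℓ pp) (euclidsLemma m p pℓ ℓ∣m*p)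

m∣m*n*o : ∀ {m} n o → m ∣ m * n * o
m∣m*n*o n o = ∣-trans (m∣m*n n) (m∣m*n o)

LeastPrimeFactor : ℕ → ℕ → Set
LeastPrimeFactor n p = Prime p × p ∣ n × (∀ {ℓ} → Prime ℓ → ℓ ∣ n → p ≤ ℓ)

leastPrimeFactor : ∀ {n} → 2 ≤ n → ∃ (LeastPrimeFactor n)
leastPrimeFactor {n} 2≤n with minimal (λ d → (2 ≤? d) ×-dec (d ∣? n)) (2≤n , ∣-refl)
... | p , _ , (2≤p , p∣n) , below = p , rough∧∣⇒prime rough p∣n , p∣n , least
  where
  instance
    p-nonTrivial : NonTrivial p
    p-nonTrivial = n>1⇒nonTrivial 2≤p
  rough : p Rough n
  rough (hasNonTrivialDivisor {d} d<p d∣n) = below d<p (nonTrivial⇒n>1 d , d∣n)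
  least : ∀ {ℓ} → Prime ℓ → ℓ ∣ n → p ≤ ℓ
  least pℓ ℓ∣n = ≮⇒≥ λ ℓ<p → below ℓ<p (prime≥2 pℓ , ℓ∣n)

coprime-by-primes : ∀ {m n} → (∀ {ℓ} → Prime ℓ → ℓ ∣ m → ¬ ℓ ∣ n) → Coprime m n
coprime-by-primes {m} {n} noCommon {zero} (0∣m , 0∣n) with 0∣⇒≡0 0∣m | 0∣⇒≡0 0∣n
... | refl | refl = contradiction (divides 0 refl) (noCommon prime[2] (divides 0 refl))
coprime-by-primes noCommon {suc zero}    _           = refl
coprime-by-primes noCommon {suc (suc d)} (d∣m , d∣n) with leastPrimeFactor {suc (suc d)} (s≤s (s≤s z≤n))
... | ℓ , pℓ , ℓ∣d , _ = contradiction (∣-trans ℓ∣d d∣n) (noCommon pℓ (∣-trans ℓ∣d d∣m))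

coprime-∣ˡ : ∀ {d m n} → d ∣ m → Coprime m n → Coprime d n
coprime-∣ˡ d∣m cop (i∣d , i∣n) = cop (∣-trans i∣d d∣m , i∣n)

prime∣coprime⇒∤ : ∀ {p m n} → Prime p → p ∣ m → Coprime m n → ¬ p ∣ n
prime∣coprime⇒∤ pp p∣m cop p∣n = contradiction (cop (p∣m , p∣n)) (λ p≡1 → <-irrefl (sym p≡1) (prime≥2 pp))

record ThreePrimeFactors (a : ℕ) : Set where
  field
    q₁ q₂ q₃ c   : ℕ
    q₁-least     : LeastPrimeFactor a q₁
    q₂-least     : LeastPrimeFactor (c * q₂) q₂
    q₃-prime     : Prime q₃
    q₃∣c         : q₃ ∣ c
    factorisation : a ≡ c * q₂ * q₁

Ω≤2⊎threePrimeFactors : ∀ {a} → 0 < a → (∃[ k ] Ω a k × k ≤ 2) ⊎ ThreePrimeFactors a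
Ω≤2⊎threePrimeFactors {suc zero}    _ = inj₁ (0 , Ω-one , z≤n)
Ω≤2⊎threePrimeFactors {a@(suc (suc _))} _ with leastPrimeFactor {a} (s≤s (s≤s z≤n))
... | q₁ , least₁@(pq₁ , divides b a≡b*q₁ , _) = split b a≡b*q₁
  where
  split : ∀ b → a ≡ b * q₁ → (∃[ k ] Ω a k × k ≤ 2) ⊎ ThreePrimeFactors a
  split zero          ()
  split (suc zero)    a≡q₁ = inj₁ (1 , subst (λ x → Ω x 1) (trans (*-comm q₁ 1) (sym a≡q₁)) (Ω-step pq₁ Ω-one) , s≤s z≤n)
  split b@(suc (suc _)) a≡b*q₁ with leastPrimeFactor {b} (s≤s (s≤s z≤n))
  ... | q₂ , least₂@(pq₂ , divides c b≡c*q₂ , _) = split′ c b≡c*q₂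
    where
    split′ : ∀ c → b ≡ c * q₂ → (∃[ k ] Ω a k × k ≤ 2) ⊎ ThreePrimeFactors a
    split′ zero ()
    split′ (suc zero) b≡q₂ = inj₁ (2 , subst (λ x → Ω x 2) a≡q₁*q₂ (Ω-step pq₁ (Ω-step pq₂ Ω-one)) , ≤-refl)
      where
      a≡q₁*q₂ : q₁ * (q₂ * 1) ≡ a
      a≡q₁*q₂ = sym (trans a≡b*q₁ (trans (cong (_* q₁) (trans b≡q₂ (*-comm 1 q₂))) (*-comm (q₂ * 1) q₁)))
    split′ c@(suc (suc _)) b≡c*q₂ with leastPrimeFactor {c} (s≤s (s≤s z≤n))
    ... | q₃ , pq₃ , q₃∣c , _ = inj₂ record
      { q₁ = q₁ ; q₂ = q₂ ; q₃ = q₃ ; c = c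
      ; q₁-least = least₁
      ; q₂-least = subst (λ x → LeastPrimeFactor x q₂) b≡c*q₂ least₂
      ; q₃-prime = pq₃
      ; q₃∣c = q₃∣c
      ; factorisation = trans a≡b*q₁ (cong (_* q₁) b≡c*q₂)
      }

^-cancelˡ-< : ∀ {x y} n → x ^ n < y ^ n → x < y
^-cancelˡ-< {x} {y} n xⁿ<yⁿ = ≰⇒> λ y≤x → <⇒≱ xⁿ<yⁿ (^-monoˡ-≤ n y≤x)

^-distribʳ-* : ∀ x y n → (x * y) ^ n ≡ x ^ n * y ^ n
^-distribʳ-* x y zero    = refl
^-distribʳ-* x y (suc n) = trans (cong (x * y *_) (^-distribʳ-* x y n)) (*-interchange x y (x ^ n) (y ^ n))
  where open import Algebra.Properties.CommutativeSemigroup *-commutativeSemigroup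
          renaming (interchange to *-interchange)

1^n*m≡m : ∀ n m → 1 ^ n * m ≡ m
1^n*m≡m n m = trans (cong (_* m) (^-zeroˡ n)) (*-identityˡ m)

1≤m^n : ∀ {m} n → 1 ≤ m → 1 ≤ m ^ n
1≤m^n {m} n 1≤m = subst (_≤ m ^ n) (^-zeroˡ n) (^-monoˡ-≤ n 1≤m)

ℤ+-*-<⇒< : ∀ {a b c d} → + a ℤ.* + b ℤ.< + c ℤ.* + d → a * b < c * d
ℤ+-*-<⇒< {a} {b} {c} {d} lt with subst₂ ℤ._<_ (sym (ℤ.pos-* a b)) (sym (ℤ.pos-* c d)) lt
... | ℤ.+<+ ab<cd = ab<cd

2≤m^[1+n] : ∀ {m} n → 2 ≤ m → 2 ≤ m ^ suc n
2≤m^[1+n] {m} n 2≤m = ≤-trans 2≤m (m≤m*n m (m ^ n) {{m^n≢0 m n {{>-nonZero (<-trans z<s 2≤m)}}}})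

module _ {N : ℕ} where

  ¬x<N^s⇒N^r<x : ∀ {x} r s → 2 ≤ N → r ℚ.< s → ¬ LtPowℚ x N s → MulPowLt 1 N r x
  ¬x<N^s⇒N^r<x {zero} r (mkℚ (+ k) _ _) 2≤N _ x≮N^s =
    contradiction (m^n>0 N {{>-nonZero (<-trans z<s 2≤N)}} k) x≮N^s
  ¬x<N^s⇒N^r<x {zero} r (mkℚ -[1+ _ ] _ _) _ _ x≮N^s = contradiction z<s x≮N^s
  ¬x<N^s⇒N^r<x {x@(suc _)} (mkℚ (+ k) e₋₁ _) (mkℚ (+ l) f₋₁ _) 2≤N (ℚ.*<* kf<le) x≮N^s =
    subst (_< x ^ e) (sym (1^n*m≡m e (N ^ k))) (^-cancelˡ-< f (begin-strict
      (N ^ k) ^ f   ≡⟨ ^-*-assoc N k f ⟩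
      N ^ (k * f)   <⟨ ^-monoʳ-< N 2≤N (ℤ+-*-<⇒< {k} {f} {l} {e} kf<le) ⟩
      N ^ (l * e)   ≡⟨ ^-*-assoc N l e ⟨
      (N ^ l) ^ e   ≤⟨ ^-monoˡ-≤ e (≮⇒≥ x≮N^s) ⟩
      (x ^ f) ^ e   ≡⟨ ^-*-assoc x f e ⟩
      x ^ (f * e)   ≡⟨ cong (x ^_) (*-comm f e) ⟩
      x ^ (e * f)   ≡⟨ ^-*-assoc x e f ⟨
      (x ^ e) ^ f   ∎))
    where
    open ≤-Reasoning
    e f : ℕ
    e = suc e₋₁
    f = suc f₋₁
  ¬x<N^s⇒N^r<x {x@(suc _)} (mkℚ -[1+ m ] e₋₁ _) _ 2≤N _ _ =
    subst (_< x ^ e * N ^ suc m) (sym (^-zeroˡ e)) (*-mono-≤ (1≤m^n e z<s) (2≤m^[1+n] m 2≤N))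
    where
    e : ℕ
    e = suc e₋₁
  ¬x<N^s⇒N^r<x {suc _} (mkℚ (+ k) e₋₁ _) (mkℚ -[1+ l ] f₋₁ _) _ (ℚ.*<* kf<le) _
    with subst (ℤ._< -[1+ l ] ℤ.* + suc e₋₁) (sym (ℤ.pos-* k (suc f₋₁))) kf<le
  ... | ()

  x<N^r≤y⇒x<y : ∀ {x y} r → 1 ≤ N → LtPowℚ x N r → MulPowLt 1 N r y → x < y
  x<N^r≤y⇒x<y (mkℚ (+ k) e₋₁ _) _ xᵉ<Nᵏ Nᵏ<yᵉ =
    ^-cancelˡ-< (suc e₋₁) (<-trans xᵉ<Nᵏ (subst (_< _) (1^n*m≡m (suc e₋₁) (N ^ k)) Nᵏ<yᵉ))
  x<N^r≤y⇒x<y {zero} {zero}  (mkℚ -[1+ _ ] _ _) _ _ 1<0 = contradiction 1<0 (λ ())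
  x<N^r≤y⇒x<y {zero} {suc _} (mkℚ -[1+ _ ] _ _) _ _ _   = z<s
  x<N^r≤y⇒x<y {suc _} (mkℚ -[1+ m ] e₋₁ _) 1≤N xᵉNᵐ<1 _ =
    contradiction xᵉNᵐ<1 (≤⇒≯ (*-mono-≤ (1≤m^n (suc e₋₁) z<s) (1≤m^n (suc m) 1≤N)))

  N^r<x≤y⇒N^r<y : ∀ {x y} r → MulPowLt 1 N r x → x ≤ y → MulPowLt 1 N r y
  N^r<x≤y⇒N^r<y (mkℚ (+ _)      e₋₁ _) lt x≤y = <-≤-trans lt (^-monoˡ-≤ (suc e₋₁) x≤y)
  N^r<x≤y⇒N^r<y (mkℚ -[1+ _ ] e₋₁ _) lt x≤y = <-≤-trans lt (*-monoˡ-≤ _ (^-monoˡ-≤ (suc e₋₁) x≤y))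

  x≤y<N^r⇒x<N^r : ∀ {x y} r → x ≤ y → LtPowℚ y N r → LtPowℚ x N r
  x≤y<N^r⇒x<N^r (mkℚ (+ _)      e₋₁ _) x≤y lt = ≤-<-trans (^-monoˡ-≤ (suc e₋₁) x≤y) lt
  x≤y<N^r⇒x<N^r (mkℚ -[1+ _ ] e₋₁ _) x≤y lt = ≤-<-trans (*-monoˡ-≤ _ (^-monoˡ-≤ (suc e₋₁) x≤y)) lt

  -- Constructive thanks to the roundedness of the cut.
  ¬LtPow⇒PowLe : ∀ {x} (κ : Real) → 2 ≤ N → ¬ LtPow x N κ → PowLe N κ x
  ¬LtPow⇒PowLe κ 2≤N x≮N^κ r r<κ with rounded κ r<κ
  ... | s , r<s , s<κ = ¬x<N^s⇒N^r<x r s 2≤N r<s (λ x<N^s → x≮N^κ (s , s<κ , x<N^s))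

  PowLe-≤-trans : ∀ {x y} (κ : Real) → PowLe N κ x → x ≤ y → PowLe N κ y
  PowLe-≤-trans κ N^κ≤x x≤y r r<κ = N^r<x≤y⇒N^r<y r (N^κ≤x r r<κ) x≤y

  ≤-LtPow-trans : ∀ {x y} (κ : Real) → x ≤ y → LtPow y N κ → LtPow x N κ
  ≤-LtPow-trans κ x≤y (r , r<κ , y<N^r) = r , r<κ , x≤y<N^r⇒x<N^r r x≤y y<N^r

  LtPow-PowLe⇒< : ∀ {x y} (κ : Real) → 1 ≤ N → LtPow x N κ → PowLe N κ y → x < y
  LtPow-PowLe⇒< κ 1≤N (r , r<κ , x<N^r) N^κ≤y = x<N^r≤y⇒x<y r 1≤N x<N^r (N^κ≤y r r<κ)

L-¬L⇒< : ∀ (x : Real) {r q} → L x r → ¬ L x q → r ℚ.< q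
L-¬L⇒< x {r} {q} r<x q≮x with ℚ.<-cmp r q
... | tri< r<q _ _ = r<q
... | tri≈ _ refl _ = contradiction r<x q≮x
... | tri> _ _ q<r = contradiction (downward x q<r r<x) q≮x

<ℝ-<ℝℚ⇒L< : ∀ (κ σ : Real) {q r} → κ <ℝ σ → σ <ℝℚ q → L κ r → r ℚ.< q
<ℝ-<ℝℚ⇒L< κ σ (s , κ≤s , s<σ) (t , σ≤t , t<q) r<κ =
  ℚ.<-trans (ℚ.<-trans (L-¬L⇒< κ r<κ κ≤s) (L-¬L⇒< σ s<σ σ≤t)) t<q

indicator-anyUpTo?≤∑ : ∀ {P : ℕ → Set} (P? : Decidable P) n →
  indicator (anyUpTo? P? n) ≤ ∑[ i < n ] indicator (P? i)
indicator-anyUpTo?≤∑ P? zero = z≤n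
indicator-anyUpTo?≤∑ P? (suc n) with P? n | anyUpTo? P? n | indicator-anyUpTo?≤∑ P? n
... | yes _ | _     | _  = m≤n+m 1 _
... | no  _ | yes _ | ih = ≤-trans ih (m≤m+n _ 0)
... | no  _ | no  _ | _  = z≤n

multiples : ℕ → ℕ → ℕ
multiples d K = ∑[ m < K ] indicator (d ∣? suc m)

-- The invariant pins multiples d K down to ⌊K/d⌋.
multiples-bounds : ∀ d K → .{{NonZero d}} → d * multiples d K ≤ K × K < d * multiples d K + d
multiples-bounds d zero = ≤-reflexive (*-zeroʳ d) , <-≤-trans (>-nonZero⁻¹ d) (m≤n+m d (d * 0))
multiples-bounds d (suc K) with multiples-bounds d K | d ∣? suc K
... | low , high | yes (divides j 1+K≡j*d) = low′ , high′
  where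
  open ≤-Reasoning
  c : ℕ
  c = multiples d K
  c<j : c < j
  c<j = *-cancelˡ-< d c j (begin-strict
    d * c <⟨ s≤s low ⟩
    suc K ≡⟨ 1+K≡j*d ⟩
    j * d ≡⟨ *-comm j d ⟩
    d * j ∎)
  d*[c+1]≡d*c+d : d * (c + 1) ≡ d * c + d
  d*[c+1]≡d*c+d = trans (*-distribˡ-+ d c 1) (cong (_+_ (d * c)) (*-identityʳ d))
  low′ : d * (c + 1) ≤ suc K
  low′ = begin
    d * (c + 1) ≤⟨ *-monoʳ-≤ d (subst (_≤ j) (+-comm 1 c) c<j) ⟩
    d * j       ≡⟨ *-comm d j ⟩
    j * d       ≡⟨ 1+K≡j*d ⟨
    suc K       ∎
  high′ : suc K < d * (c + 1) + d
  high′ = begin-strict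
    suc K           ≤⟨ high ⟩
    d * c + d       ≡⟨ d*[c+1]≡d*c+d ⟨
    d * (c + 1)     <⟨ m<m+n _ (>-nonZero⁻¹ d) ⟩
    d * (c + 1) + d ∎
... | low , high | no d∤1+K = low′ , high′
  where
  c : ℕ
  c = multiples d K
  d*[c+0]≡d*c : d * (c + 0) ≡ d * c
  d*[c+0]≡d*c = cong (d *_) (+-identityʳ c)
  low′ : d * (c + 0) ≤ suc K
  low′ = subst (_≤ suc K) (sym d*[c+0]≡d*c) (m≤n⇒m≤1+n low)
  high′ : suc K < d * (c + 0) + d
  high′ = subst (λ x → suc K < x + d) (sym d*[c+0]≡d*c)
    (≤∧≢⇒< high λ 1+K≡d*c+d → d∤1+K (subst (d ∣_) (sym 1+K≡d*c+d) (∣m∣n⇒∣m+n (m∣m*n c) ∣-refl)))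

-- Σ_{ℓ > t} N/ℓ² ≤ N/t, via ℓ⁻² ≤ (ℓ-1)⁻¹ - ℓ⁻¹.
telescoping : ∀ N t k → t * ∑[ i < k ] multiples ((suc t + i) * (suc t + i)) N ≤ N
telescoping N t zero    = ≤-trans (≤-reflexive (*-zeroʳ t)) z≤n
telescoping N t (suc k) = *-cancelˡ-≤ (suc t) (begin
  suc t * (t * ∑[ i < suc k ] f t i) ≡⟨ cong (λ x → suc t * (t * x)) ∑≡u+w ⟩
  suc t * (t * (u + w))             ≡⟨ solve 3 (λ t u w → (con 1 :+ t) :* (t :* (u :+ w))
                                         := t :* ((con 1 :+ t) :* u) :+ t :* ((con 1 :+ t) :* w)) refl t u w ⟩
  t * (suc t * u) + t * (suc t * w) ≤⟨ +-mono-≤ t*[1+t]*u≤N (*-monoʳ-≤ t (telescoping N (suc t) k)) ⟩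
  N + t * N                         ∎)
  where
  open ≤-Reasoning
  open +-*-Solver
  f : ℕ → ℕ → ℕ
  f t i = multiples ((suc t + i) * (suc t + i)) N
  u w : ℕ
  u = multiples (suc t * suc t) N
  w = ∑[ i < k ] f (suc t) i
  ∑≡u+w : ∑[ i < suc k ] f t i ≡ u + w
  ∑≡u+w = trans (∑-split-head (f t) k)
    (cong₂ _+_ (cong (λ ℓ → multiples (ℓ * ℓ) N) (+-identityʳ (suc t)))
               (∑-cong k λ i → cong (λ ℓ → multiples (ℓ * ℓ) N) (+-suc (suc t) i)))
  t*[1+t]*u≤N : t * (suc t * u) ≤ N
  t*[1+t]*u≤N = begin
    t * (suc t * u)     ≤⟨ *-monoˡ-≤ (suc t * u) (n≤1+n t) ⟩
    suc t * (suc t * u) ≡⟨ *-assoc (suc t) (suc t) u ⟨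
    suc t * suc t * u   ≤⟨ proj₁ (multiples-bounds (suc t * suc t) N) ⟩
    N                   ∎

primeDivisor? : ∀ N p → Dec (Prime p × p ∣ N)
primeDivisor? N p = prime? p ×-dec p ∣? N

primeRadical< : ℕ → ℕ → ℕ
primeRadical< N zero    = 1
primeRadical< N (suc j) with primeDivisor? N j
... | yes _ = primeRadical< N j * j
... | no  _ = primeRadical< N j

prime∤primeRadical< : ∀ {N p} j → j ≤ p → Prime p → ¬ p ∣ primeRadical< N j
prime∤primeRadical<         zero    _   pp p∣1 = <-irrefl (sym (∣1⇒≡1 p∣1)) (prime≥2 pp)
prime∤primeRadical< {N} {p} (suc j) j<p pp p∣rad with primeDivisor? N j
... | no _ = prime∤primeRadical< j (<⇒≤ j<p) pp p∣rad
... | yes (pj , _) with euclidsLemma (primeRadical< N j) j pp p∣rad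
...   | inj₁ p∣rad′ = prime∤primeRadical< j (<⇒≤ j<p) pp p∣rad′
...   | inj₂ p∣j    = <⇒≱ j<p (∣⇒≤ {{prime⇒nonZero pj}} p∣j)

primeRadical<∣ : ∀ N j → primeRadical< N j ∣ N
primeRadical<∣ N zero    = divides N (sym (*-identityʳ N))
primeRadical<∣ N (suc j) with primeDivisor? N j | primeRadical<∣ N j
... | no _          | rad∣N = rad∣N
... | yes (pj , j∣N) | divides m N≡m*rad
  with euclidsLemma m (primeRadical< N j) pj (subst (j ∣_) N≡m*rad j∣N)
...   | inj₂ j∣rad = contradiction j∣rad (prime∤primeRadical< j ≤-refl pj)
...   | inj₁ (divides l m≡l*j) = divides l (begin
  N                        ≡⟨ N≡m*rad ⟩
  m * primeRadical< N j    ≡⟨ cong (_* primeRadical< N j) m≡l*j ⟩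
  l * j * primeRadical< N j ≡⟨ *-assoc l j _ ⟩
  l * (j * primeRadical< N j) ≡⟨ cong (l *_) (*-comm j _) ⟩
  l * (primeRadical< N j * j) ∎)
  where open ≡-Reasoning

2^ω≤primeRadical< : ∀ N j → 2 ^ ∑[ p < j ] indicator (primeDivisor? N p) ≤ primeRadical< N j
2^ω≤primeRadical< N zero    = ≤-refl
2^ω≤primeRadical< N (suc j)
  rewrite ^-distribˡ-+-* 2 (∑[ p < j ] indicator (primeDivisor? N p)) (indicator (primeDivisor? N j))
  with primeDivisor? N j
... | yes (pj , _) = *-mono-≤ (2^ω≤primeRadical< N j) (prime≥2 pj)
... | no  _        = ≤-trans (≤-reflexive (*-identityʳ _)) (2^ω≤primeRadical< N j)

n<2^n : ∀ n → n < 2 ^ n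
n<2^n zero    = z<s
n<2^n (suc n) = begin-strict
  suc n                 ≤⟨ n<2^n n ⟩
  2 ^ n                 <⟨ m<m+n (2 ^ n) (m^n>0 2 n) ⟩
  2 ^ n + 2 ^ n         ≡⟨ cong (_+_ (2 ^ n)) (+-identityʳ (2 ^ n)) ⟨
  2 ^ suc n             ∎
  where open ≤-Reasoning

n*n≤2*2^n : ∀ n → n * n ≤ 2 * 2 ^ n
n*n≤2*2^n zero    = z≤n
n*n≤2*2^n (suc n) = begin
  suc n * suc n             ≡⟨ solve 1 (λ n → (con 1 :+ n) :* (con 1 :+ n) := n :* n :+ (con 2 :* n :+ con 1)) refl n ⟩
  n * n + (2 * n + 1)       ≤⟨ +-mono-≤ (n*n≤2*2^n n) 2n+1≤2*2^n ⟩
  2 * 2 ^ n + 2 * 2 ^ n     ≡⟨ solve 1 (λ x → con 2 :* x :+ con 2 :* x := con 2 :* (con 2 :* x)) refl (2 ^ n) ⟩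
  2 * 2 ^ suc n             ∎
  where
  open ≤-Reasoning
  open +-*-Solver
  2n+1≤2*2^n : 2 * n + 1 ≤ 2 * 2 ^ n
  2n+1≤2*2^n = begin
    2 * n + 1   ≤⟨ +-monoʳ-≤ (2 * n) (n≤1+n 1) ⟩
    2 * n + 2   ≡⟨ solve 1 (λ n → con 2 :* n :+ con 2 := con 2 :* (con 1 :+ n)) refl n ⟩
    2 * suc n   ≤⟨ *-monoʳ-≤ 2 (n<2^n n) ⟩
    2 * 2 ^ n   ∎

m*m≤n*n⇒m≤n : ∀ {m n} → m * m ≤ n * n → m ≤ n
m*m≤n*n⇒m≤n m*m≤n*n = ≮⇒≥ λ n<m → <⇒≱ (*-mono-< n<m n<m) m*m≤n*n

squareWeight : ℕ → ℕ → ℕ → ℕ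
squareWeight N T m = indicator (anyUpTo? (λ i → (T + i) * (T + i) ∣? m) (suc N ∸ T))

-- Positive exactly when q ∣ N (q prime) or ℓ² ∣ N − q for some T ≤ ℓ ≤ N.
exceptionalWeight : ℕ → ℕ → ℕ → ℕ
exceptionalWeight N T q = indicator (primeDivisor? N q) + squareWeight N T (N ∸ q)

exceptionalWeight≡0⇒ : ∀ {N T q} → exceptionalWeight N T q ≡ 0 →
  ¬ (Prime q × q ∣ N) × (∀ {ℓ} → T ≤ ℓ → ℓ ≤ N → ¬ ℓ * ℓ ∣ N ∸ q)
exceptionalWeight≡0⇒ {N} {T} {q} e≡0 =
  indicator≡0⇒¬ (primeDivisor? N q) (m+n≡0⇒m≡0 _ e≡0) ,
  λ {ℓ} T≤ℓ ℓ≤N ℓ*ℓ∣a → indicator≡0⇒¬ (anyUpTo? _ (suc N ∸ T)) (m+n≡0⇒n≡0 _ e≡0)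
    (ℓ ∸ T , ∸-monoˡ-< (s≤s ℓ≤N) T≤ℓ , subst (λ x → x * x ∣ N ∸ q) (sym (m+[n∸m]≡n T≤ℓ)) ℓ*ℓ∣a)

∑squareWeight≤ : ∀ N T → ∑[ q < suc N ] squareWeight N T (N ∸ q) ≤
                         1 + ∑[ i < suc N ∸ T ] multiples ((T + i) * (T + i)) N
∑squareWeight≤ N T = begin
  ∑[ q < suc N ] squareWeight N T (N ∸ q)      ≡⟨ ∑-reverse (squareWeight N T) N ⟩
  ∑[ m < suc N ] squareWeight N T m            ≡⟨ ∑-split-head (squareWeight N T) N ⟩
  squareWeight N T 0 + ∑[ m < N ] squareWeight N T (suc m)
    ≤⟨ +-mono-≤ (indicator≤1 (anyUpTo? _ (suc N ∸ T)))
                (∑-mono-≤ N λ m _ → indicator-anyUpTo?≤∑ (λ i → (T + i) * (T + i) ∣? suc m) (suc N ∸ T)) ⟩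
  1 + ∑[ m < N ] ∑[ i < suc N ∸ T ] indicator ((T + i) * (T + i) ∣? suc m)
    ≡⟨ cong (_+_ 1) (∑-comm (λ i m → indicator ((T + i) * (T + i) ∣? suc m)) N (suc N ∸ T)) ⟩
  1 + ∑[ i < suc N ∸ T ] multiples ((T + i) * (T + i)) N ∎
  where open ≤-Reasoning

ω*t≤2N : ∀ {N t} → t * t < N → ∑[ p < suc N ] indicator (primeDivisor? N p) * t ≤ 2 * N
ω*t≤2N {N} {t} t*t<N = m*m≤n*n⇒m≤n (begin
  s * t * (s * t)     ≡⟨ solve 2 (λ s t → s :* t :* (s :* t) := s :* s :* (t :* t)) refl s t ⟩
  s * s * (t * t)     ≤⟨ *-mono-≤ (≤-trans (n*n≤2*2^n s) (*-monoʳ-≤ 2 2^s≤N)) (<⇒≤ t*t<N) ⟩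
  2 * N * N           ≤⟨ *-monoʳ-≤ (2 * N) (m≤n*m N 2) ⟩
  2 * N * (2 * N)     ∎)
  where
  open ≤-Reasoning
  open +-*-Solver
  s : ℕ
  s = ∑[ p < suc N ] indicator (primeDivisor? N p)
  2^s≤N : 2 ^ s ≤ N
  2^s≤N = ≤-trans (2^ω≤primeRadical< N (suc N))
    (∣⇒≤ {{>-nonZero (≤-<-trans z≤n t*t<N)}} (primeRadical<∣ N (suc N)))

∑exceptionalWeight*T≤7N : ∀ {N t} → 1 ≤ t → t * t < N → suc t ≤ N →
  ∑[ q < suc N ] exceptionalWeight N (suc t) q * suc t ≤ 7 * N
∑exceptionalWeight*T≤7N {N} {t} 1≤t t*t<N T≤N = begin
  ∑[ q < suc N ] exceptionalWeight N T q * T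
    ≡⟨ cong (_* T) (∑-distrib-+ (suc N)) ⟩
  (s + ∑[ q < suc N ] squareWeight N T (N ∸ q)) * T
    ≤⟨ *-monoˡ-≤ T (+-monoʳ-≤ s (∑squareWeight≤ N T)) ⟩
  (s + (1 + S)) * T
    ≡⟨ solve 3 (λ s S T → (s :+ (con 1 :+ S)) :* T := s :* T :+ T :+ S :* T) refl s S T ⟩
  s * T + T + S * T
    ≤⟨ +-mono-≤ (+-mono-≤ (*-monoʳ-≤ s T≤2t) T≤N) (*-monoʳ-≤ S T≤2t) ⟩
  s * (2 * t) + N + S * (2 * t)
    ≡⟨ solve 4 (λ s S t N → s :* (con 2 :* t) :+ N :+ S :* (con 2 :* t)
                          := con 2 :* (s :* t) :+ N :+ con 2 :* (t :* S)) refl s S t N ⟩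
  2 * (s * t) + N + 2 * (t * S)
    ≤⟨ +-mono-≤ (+-monoˡ-≤ N (*-monoʳ-≤ 2 (ω*t≤2N t*t<N))) (*-monoʳ-≤ 2 (telescoping N t (N ∸ t))) ⟩
  2 * (2 * N) + N + 2 * N
    ≡⟨ solve 1 (λ N → con 2 :* (con 2 :* N) :+ N :+ con 2 :* N := con 7 :* N) refl N ⟩
  7 * N ∎
  where
  open ≤-Reasoning
  open +-*-Solver
  T s S : ℕ
  T = suc t
  s = ∑[ p < suc N ] indicator (primeDivisor? N p)
  S = ∑[ i < N ∸ t ] multiples ((T + i) * (T + i)) N
  T≤2t : T ≤ 2 * t
  T≤2t = subst₂ _≤_ (+-comm t 1) (cong (_+_ t) (sym (+-identityʳ t))) (+-monoʳ-≤ t 1≤t)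

module Sieve (κ σ : Real) (N : ℕ) (4≤N : 4 ≤ N) where

  2≤N : 2 ≤ N
  2≤N = ≤-trans (s≤s (s≤s z≤n)) 4≤N

  1≤N : 1 ≤ N
  1≤N = <-trans z<s 2≤N

  Sifted : ℕ → (ℕ → Set) → ℕ → Set
  Sifted m Below q = ∀ ℓ → Prime ℓ → Below ℓ → ¬ (ℓ ∣ m) → ¬ (ℓ ∣ N ∸ q)

  sifted-below⇒≥ : ∀ {p₁ p₂ q ℓ} → Sifted (N * p₁) (_< p₂) q →
    Prime p₁ → Prime ℓ → ℓ ∣ N ∸ q → ¬ ℓ ∣ N → ℓ ≢ p₁ → p₂ ≤ ℓ
  sifted-below⇒≥ {p₁} sifted pp₁ pℓ ℓ∣a ℓ∤N ℓ≢p₁ =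
    ≮⇒≥ λ ℓ<p₂ → sifted _ pℓ ℓ<p₂ ([ ℓ∤N , ℓ≢p₁ ]′ ∘ prime∣m*p⇒∣m⊎≡p pℓ pp₁) ℓ∣a

  S4⇒S1 : ∀ {p₁ p₂ p₃ q p} → S4Set N κ σ (p₁ , p₂ , p₃ , q) →
    Prime p → p₁ ≤ p → p ≤ p₃ → p ∣ p₁ * p₂ * p₃ → S1Set N κ σ (p , q)
  S4⇒S1 {p₁} {q = q} (pp₁ , _ , _ , N^κ≤p₁ , p₁<p₂ , _ , p₃<N^σ , coprime , (pq , q≤N , p₁p₂p₃∣a , sifted))
        pp p₁≤p p≤p₃ p∣p₁p₂p₃ =
    pp , PowLe-≤-trans κ N^κ≤p₁ p₁≤p , ≤-LtPow-trans σ p≤p₃ p₃<N^σ , coprime-∣ˡ p∣p₁p₂p₃ coprime ,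
    (pq , q≤N , ∣-trans p∣p₁p₂p₃ p₁p₂p₃∣a , sifted₀)
    where
    sifted₀ : Sifted N (λ ℓ → LtPow ℓ N κ) q
    sifted₀ ℓ pℓ ℓ<N^κ ℓ∤N = sifted ℓ pℓ (<-trans ℓ<p₁ p₁<p₂)
      ([ ℓ∤N , (λ ℓ≡p₁ → <-irrefl ℓ≡p₁ ℓ<p₁) ]′ ∘ prime∣m*p⇒∣m⊎≡p pℓ pp₁)
      where
      ℓ<p₁ : ℓ < p₁
      ℓ<p₁ = LtPow-PowLe⇒< κ 1≤N ℓ<N^κ N^κ≤p₁

  S4-divisor : ∀ {p₁ p₂ p₃ q p} → S4Set N κ σ (p₁ , p₂ , p₃ , q) →
    Prime p → p ∣ p₁ * p₂ * p₃ → p ∣ N ∸ q × ¬ p ∣ N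
  S4-divisor (_ , _ , _ , _ , _ , _ , _ , coprime , (_ , _ , p₁p₂p₃∣a , _)) pp p∣p₁p₂p₃ =
    ∣-trans p∣p₁p₂p₃ p₁p₂p₃∣a , prime∣coprime⇒∤ pp p∣p₁p₂p₃ coprime

  S4-divisor-≥ : ∀ {p₁ p₂ p₃ p₁′ p₂′ p₃′ q p} →
    S4Set N κ σ (p₁ , p₂ , p₃ , q) → S4Set N κ σ (p₁′ , p₂′ , p₃′ , q) →
    Prime p → p ∣ p₁′ * p₂′ * p₃′ → p ≢ p₁ → p₂ ≤ p
  S4-divisor-≥ {q = q} (pp₁ , _ , _ , _ , _ , _ , _ , _ , (_ , _ , _ , sifted)) s′ pp p∣ p≢p₁ =
    let p∣a , p∤N = S4-divisor s′ pp p∣ in sifted-below⇒≥ {q = q} sifted pp₁ pp p∣a p∤N p≢p₁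

  -- The sieve condition of S₄ forbids prime factors of N − q strictly between p₁ and p₂.
  S4-leading-unique : ∀ {p₁ p₂ p₃ p₁′ p₂′ p₃′ q} →
    S4Set N κ σ (p₁ , p₂ , p₃ , q) → S4Set N κ σ (p₁′ , p₂′ , p₃′ , q) → p₁ ≡ p₁′ × p₂ ≡ p₂′
  S4-leading-unique {p₁} {p₂} {p₃} {p₁′} {p₂′} {p₃′}
                    s@(pp₁ , pp₂ , _ , _ , p₁<p₂ , _) s′@(pp₁′ , pp₂′ , _ , _ , p₁′<p₂′ , _) =
    p₁≡p₁′ , ≤-antisym
      (S4-divisor-≥ s s′ pp₂′ (n∣m*n*o p₁′ p₃′) λ p₂′≡p₁ → <-irrefl (sym (trans p₂′≡p₁ p₁≡p₁′)) p₁′<p₂′)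
      (S4-divisor-≥ s′ s pp₂ (n∣m*n*o p₁ p₃) λ p₂≡p₁′ → <-irrefl (sym (trans p₂≡p₁′ (sym p₁≡p₁′))) p₁<p₂)
    where
    p₁≡p₁′ : p₁ ≡ p₁′
    p₁≡p₁′ = decidable-stable (p₁ ≟ p₁′) λ p₁≢p₁′ → <-asym
      (<-≤-trans p₁<p₂ (S4-divisor-≥ s s′ pp₁′ (m∣m*n*o p₂′ p₃′) (p₁≢p₁′ ∘ sym)))
      (<-≤-trans p₁′<p₂′ (S4-divisor-≥ s′ s pp₁ (m∣m*n*o p₂ p₃) p₁≢p₁′))

  NonExceptional : ℕ → Set
  NonExceptional q = ¬ q ∣ N × (∀ {ℓ} → Prime ℓ → ¬ LtPow ℓ N κ → ¬ ℓ * ℓ ∣ N ∸ q)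

  -- The ways in which q contributes at least 2 to 2·D + S₁ + 2·S₂ + S₃.
  data Covered (q : ℕ) : Set where
    almost-prime : D12Set N q → Covered q
    S1-S1 : ∀ {p p′} → p ≢ p′ → S1Set N κ σ (p , q) → S1Set N κ σ (p′ , q) → Covered q
    S1-S3 : ∀ {p₁ p₂} → S1Set N κ σ (p₁ , q) → S3Set N κ σ (p₁ , p₂ , q) → Covered q
    S2    : ∀ {p₁ p₂} → S2Set N κ σ (p₁ , p₂ , q) → Covered q

  module Admissible {q} (s₀ : S0Set N κ q) (nonExceptional : NonExceptional q) where

    pq : Prime q
    pq = proj₁ s₀
    q≤N : q ≤ N
    q≤N = proj₁ (proj₂ s₀)
    sifted : Sifted N (λ ℓ → LtPow ℓ N κ) q
    sifted = proj₂ (proj₂ (proj₂ s₀))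
    q∤N : ¬ q ∣ N
    q∤N = proj₁ nonExceptional
    squarefree : ∀ {ℓ} → Prime ℓ → ¬ LtPow ℓ N κ → ¬ ℓ * ℓ ∣ N ∸ q
    squarefree = proj₂ nonExceptional

    0<a : 0 < N ∸ q
    0<a = m<n⇒0<n∸m (≤∧≢⇒< q≤N λ q≡N → q∤N (subst (q ∣_) q≡N ∣-refl))

    a<N : N ∸ q < N
    a<N = ∸-monoʳ-< (<-trans z<s (prime≥2 pq)) q≤N

    prime-divisor : ∀ {ℓ} → Prime ℓ → ℓ ∣ N ∸ q → ¬ ℓ ∣ N × ¬ LtPow ℓ N κ
    prime-divisor {ℓ} pℓ ℓ∣a = ℓ∤N , λ ℓ<N^κ → sifted ℓ pℓ ℓ<N^κ ℓ∤N ℓ∣a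
      where
      ℓ∤N : ¬ ℓ ∣ N
      ℓ∤N ℓ∣N = q∤N (subst (_∣ N) (prime∣prime⇒≡ pℓ pq ℓ∣q) ℓ∣N)
        where
        ℓ∣q : ℓ ∣ q
        ℓ∣q = ∣m+n∣m⇒∣n (subst (ℓ ∣_) (sym (m∸n+n≡m q≤N)) ℓ∣N) ℓ∣a

    divisor-coprime : ∀ {d} → d ∣ N ∸ q → Coprime d N
    divisor-coprime d∣a = coprime-by-primes λ pℓ ℓ∣d → proj₁ (prime-divisor pℓ (∣-trans ℓ∣d d∣a))

    S1-of-divisor : ∀ {p} → Prime p → p ∣ N ∸ q → LtPow p N σ → S1Set N κ σ (p , q)
    S1-of-divisor pp p∣a p<N^σ =
      pp , ¬LtPow⇒PowLe κ 2≤N (proj₂ (prime-divisor pp p∣a)) , p<N^σ , divisor-coprime p∣a ,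
      (pq , q≤N , p∣a , sifted)

    module _ (three : ThreePrimeFactors (N ∸ q)) where

      open ThreePrimeFactors three

      pq₁ : Prime q₁
      pq₁ = proj₁ q₁-least

      pq₂ : Prime q₂
      pq₂ = proj₁ q₂-least

      c*q₂∣a : c * q₂ ∣ N ∸ q
      c*q₂∣a = divides q₁ (trans factorisation (*-comm (c * q₂) q₁))

      q₁∣a : q₁ ∣ N ∸ q
      q₁∣a = proj₁ (proj₂ q₁-least)

      q₂∣a : q₂ ∣ N ∸ q
      q₂∣a = ∣-trans (n∣m*n c) c*q₂∣a

      q₁*q₂∣a : q₁ * q₂ ∣ N ∸ q
      q₁*q₂∣a = divides c (trans factorisation (trans (*-assoc c q₂ q₁) (cong (c *_) (*-comm q₂ q₁))))

      q₁<q₂ : q₁ < q₂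
      q₁<q₂ = ≤∧≢⇒< (proj₂ (proj₂ q₁-least) pq₂ q₂∣a) λ q₁≡q₂ →
        squarefree pq₁ (proj₂ (prime-divisor pq₁ q₁∣a)) (subst (λ p → q₁ * p ∣ N ∸ q) (sym q₁≡q₂) q₁*q₂∣a)

      q₂<q₃ : q₂ < q₃
      q₂<q₃ = ≤∧≢⇒< (proj₂ (proj₂ q₂-least) q₃-prime (∣-trans q₃∣c (m∣m*n q₂))) λ q₂≡q₃ →
        squarefree pq₂ (proj₂ (prime-divisor pq₂ q₂∣a))
          (∣-trans (subst (λ p → p * q₂ ∣ c * q₂) (sym q₂≡q₃) (*-pres-∣ q₃∣c ∣-refl)) c*q₂∣a)

      q₃≤c : q₃ ≤ c
      q₃≤c = ∣⇒≤ {{m*n≢0⇒m≢0 c {{m*n≢0⇒m≢0 (c * q₂) {{>-nonZero (subst (0 <_) factorisation 0<a)}}}}}} q₃∣c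

      q₂*q₂*q₁<N : q₂ * q₂ * q₁ < N
      q₂*q₂*q₁<N = begin-strict
        q₂ * q₂ * q₁ <⟨ *-monoˡ-< q₁ {{prime⇒nonZero pq₁}} (*-monoˡ-< q₂ {{prime⇒nonZero pq₂}} q₂<q₃) ⟩
        q₃ * q₂ * q₁ ≤⟨ *-monoˡ-≤ q₁ (*-monoˡ-≤ q₂ q₃≤c) ⟩
        c * q₂ * q₁  ≡⟨ factorisation ⟨
        N ∸ q        <⟨ a<N ⟩
        N            ∎
        where open ≤-Reasoning

      sifted₂ : Sifted (N * q₁) (_< q₂) q
      sifted₂ ℓ pℓ ℓ<q₂ ℓ∤Nq₁ ℓ∣a with prime∣m*p⇒∣m⊎≡p pℓ pq₁ (subst (ℓ ∣_) factorisation ℓ∣a)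
      ... | inj₁ ℓ∣cq₂ = <⇒≱ ℓ<q₂ (proj₂ (proj₂ q₂-least) pℓ ℓ∣cq₂)
      ... | inj₂ refl  = ℓ∤Nq₁ (n∣m*n N)

      sieved₂ : SiftSet N (q₁ * q₂) (N * q₁) (_< q₂) q
      sieved₂ = pq , q≤N , q₁*q₂∣a , sifted₂

      -- Only doubly negated, since q < N^σ is undecidable; the goal 2 ≤ weight q of its use is decidable.
      covered-by-three : ¬ ¬ Covered q
      covered-by-three ¬covered = ¬¬-excluded-middle λ where
        (no q₁≮N^σ) → ¬covered (S2 (pq₁ , pq₂ , ¬LtPow⇒PowLe σ 2≤N q₁≮N^σ , q₁<q₂ , q₂*q₂*q₁<N ,
                                     divisor-coprime q₁*q₂∣a , sieved₂))
        (yes q₁<N^σ) → ¬¬-excluded-middle λ where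
          (yes q₂<N^σ) → ¬covered (S1-S1 (<⇒≢ q₁<q₂) (S1-of-divisor pq₁ q₁∣a q₁<N^σ) (S1-of-divisor pq₂ q₂∣a q₂<N^σ))
          (no q₂≮N^σ)  → ¬covered (S1-S3 (S1-of-divisor pq₁ q₁∣a q₁<N^σ)
            (pq₁ , pq₂ , ¬LtPow⇒PowLe κ 2≤N (proj₂ (prime-divisor pq₁ q₁∣a)) , q₁<N^σ ,
             ¬LtPow⇒PowLe σ 2≤N q₂≮N^σ , q₂*q₂*q₁<N , divisor-coprime q₁*q₂∣a , sieved₂))

    covered : ¬ ¬ Covered q
    covered with Ω≤2⊎threePrimeFactors 0<a
    ... | inj₁ (k , Ωk , k≤2) = λ ¬covered → ¬covered (almost-prime (pq , q≤N , k , Ωk , k≤2))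
    ... | inj₂ three          = covered-by-three three

  last₃ : ℕ × ℕ × ℕ → ℕ
  last₃ = proj₂ ∘ proj₂

  last₄ : ℕ × ℕ × ℕ × ℕ → ℕ
  last₄ = proj₂ ∘ proj₂ ∘ proj₂

  module Counting {D s₀ s₁ s₂ s₃ s₄ : ℕ}
    (hD : HasCard (D12Set N) D) (h₀ : HasCard (S0Set N κ) s₀)
    (h₁ : HasCard (S1Set N κ σ) s₁) (h₂ : HasCard (S2Set N κ σ) s₂)
    (h₃ : HasCard (S3Set N κ σ) s₃) (h₄ : HasCard (S4Set N κ σ) s₄) where

    module CD = Card id hD
    module C₀ = Card id h₀
    module C₁ = Card proj₂ h₁
    module C₂ = Card last₃ h₂
    module C₃ = Card last₃ h₃
    module C₄ = Card last₄ h₄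

    weight : ℕ → ℕ
    weight q = 2 * CD.count q + C₁.count q + 2 * C₂.count q + C₃.count q

    weight-bounds : ∀ q → 2 * CD.count q ≤ weight q × C₁.count q + C₃.count q ≤ weight q × 2 * C₂.count q ≤ weight q
    weight-bounds q = bounds (CD.count q) (C₁.count q) (C₂.count q) (C₃.count q)
      where
      bounds : ∀ d a b c → 2 * d ≤ 2 * d + a + 2 * b + c × a + c ≤ 2 * d + a + 2 * b + c × 2 * b ≤ 2 * d + a + 2 * b + c
      bounds d a b c =
        ≤-trans (m≤m+n (2 * d) a) (≤-trans (m≤m+n (2 * d + a) (2 * b)) (m≤m+n (2 * d + a + 2 * b) c)) ,
        +-monoˡ-≤ c (≤-trans (m≤n+m a (2 * d)) (m≤m+n (2 * d + a) (2 * b))) ,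
        ≤-trans (m≤n+m (2 * b) (2 * d + a)) (m≤m+n (2 * d + a + 2 * b) c)

    covered⇒2≤weight : ∀ {q} → Covered q → 2 ≤ weight q
    covered⇒2≤weight {q} (almost-prime d) =
      ≤-trans (*-monoʳ-≤ 2 (CD.count>0 d)) (proj₁ (weight-bounds q))
    covered⇒2≤weight {q} (S1-S1 p≢p′ s s′) =
      ≤-trans (C₁.count≥2 s s′ (p≢p′ ∘ cong proj₁) refl) (≤-trans (m≤m+n _ (C₃.count q)) (proj₁ (proj₂ (weight-bounds q))))
    covered⇒2≤weight {q} (S1-S3 s s₃) =
      ≤-trans (+-mono-≤ (C₁.count>0 s) (C₃.count>0 s₃)) (proj₁ (proj₂ (weight-bounds q)))
    covered⇒2≤weight {q} (S2 s) =
      ≤-trans (*-monoʳ-≤ 2 (C₂.count>0 s)) (proj₂ (proj₂ (weight-bounds q)))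

    -- Each element of S₄ over q yields three elements of S₁ over q, the first two shared by all.
    2+count₄≤count₁ : ∀ {p₁ p₂ p₃ q} → S4Set N κ σ (p₁ , p₂ , p₃ , q) → 2 + C₄.count q ≤ C₁.count q
    2+count₄≤count₁ {p₁} {p₂} {p₃} {q} s@(pp₁ , pp₂ , _ , _ , p₁<p₂ , p₂<p₃ , _) =
      subst (_≤ C₁.count q) (cong (_+_ 2) (length-map dropLeading F)) (Unique⇒length≤ zs-unique zs⊆fibre₁)
      where
      F : List (ℕ × ℕ × ℕ × ℕ)
      F = C₄.fibre q C₄.elements

      dropLeading : ℕ × ℕ × ℕ × ℕ → ℕ × ℕ
      dropLeading (_ , _ , p , a) = p , a

      fibre-shape : ∀ {w} → w ∈ F → ∃[ p ] w ≡ (p₁ , p₂ , p , q) × S4Set N κ σ (p₁ , p₂ , p , q)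
      fibre-shape {_ , _ , p , _} w∈ with C₄.∈-count⁻ w∈
      ... | s′ , refl with S4-leading-unique s s′
      ...   | refl , refl = p , refl , s′

      above-p₂ : ∀ {z} → z ∈ map dropLeading F → p₂ < proj₁ z
      above-p₂ z∈ with ∈-map⁻ dropLeading z∈
      ... | _ , w∈ , refl with fibre-shape w∈
      ...   | _ , refl , (_ , _ , _ , _ , _ , p₂<p , _) = p₂<p

      dropLeading-injective : ∀ {w w′} → w ∈ F → w′ ∈ F → dropLeading w ≡ dropLeading w′ → w ≡ w′
      dropLeading-injective w∈ w′∈ eq with fibre-shape w∈ | fibre-shape w′∈
      ... | _ , refl , _ | _ , refl , _ = cong (λ p → p₁ , p₂ , p , q) (cong proj₁ eq)

      zs : List (ℕ × ℕ)
      zs = (p₁ , q) ∷ (p₂ , q) ∷ map dropLeading F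

      zs-unique : Unique zs
      zs-unique =
        ((<⇒≢ p₁<p₂ ∘ cong proj₁) ∷ All.tabulate (λ z∈ → <⇒≢ (<-trans p₁<p₂ (above-p₂ z∈)) ∘ cong proj₁))
        ∷ All.tabulate (λ z∈ → <⇒≢ (above-p₂ z∈) ∘ cong proj₁)
        ∷ Unique-map⁺ dropLeading-injective (C₄.fibre-unique C₄.elements-unique)

      zs⊆fibre₁ : zs ⊆ C₁.fibre q C₁.elements
      zs⊆fibre₁ (here refl) =
        C₁.∈-count⁺ (S4⇒S1 s pp₁ ≤-refl (<⇒≤ (<-trans p₁<p₂ p₂<p₃)) (m∣m*n*o p₂ p₃))
      zs⊆fibre₁ (there (here refl)) =
        C₁.∈-count⁺ (S4⇒S1 s pp₂ (<⇒≤ p₁<p₂) (<⇒≤ p₂<p₃) (n∣m*n*o p₁ p₃))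
      zs⊆fibre₁ (there (there z∈)) with ∈-map⁻ dropLeading z∈
      ... | _ , w∈ , refl with fibre-shape w∈
      ...   | p , refl , s′@(_ , _ , pp , _ , _ , p₂<p , _) =
        C₁.∈-count⁺ (S4⇒S1 s′ pp (<⇒≤ (<-trans p₁<p₂ p₂<p)) ≤-refl (n∣m*n (p₁ * p₂)))

    2*count₀≤weight+2e : ∀ q e → (e ≡ 0 → S0Set N κ q → NonExceptional q) → 2 * C₀.count q ≤ weight q + 2 * e
    2*count₀≤weight+2e q e exceptional with 0 <? C₀.count q
    ... | no  count₀≯0 = ≤-trans (*-monoʳ-≤ 2 (≮⇒≥ count₀≯0)) z≤n
    ... | yes count₀>0 with C₀.count>0⇒∃ count₀>0
    ...   | _ , s₀ , refl = ≤-trans (*-monoʳ-≤ 2 (C₀.count≤1 (λ _ _ → id) q)) (bound e exceptional)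
      where
      bound : ∀ e → (e ≡ 0 → S0Set N κ q → NonExceptional q) → 2 ≤ weight q + 2 * e
      bound zero    exceptional = ≤-trans
        (decidable-stable (2 ≤? weight q) λ 2≰weight →
          Admissible.covered s₀ (exceptional refl s₀) (2≰weight ∘ covered⇒2≤weight))
        (m≤m+n (weight q) 0)
      bound (suc e) _ = ≤-trans (*-monoʳ-≤ 2 (s≤s z≤n)) (m≤n+m (2 * suc e) (weight q))

    pointwise : ∀ q e → (e ≡ 0 → S0Set N κ q → NonExceptional q) →
      2 * C₀.count q + C₄.count q ≤ weight q + 2 * e
    pointwise q e exceptional with C₄.count q ≟ 0
    ... | yes count₄≡0 = begin
      2 * C₀.count q + C₄.count q ≡⟨ cong (_+_ (2 * C₀.count q)) count₄≡0 ⟩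
      2 * C₀.count q + 0          ≡⟨ +-identityʳ _ ⟩
      2 * C₀.count q              ≤⟨ 2*count₀≤weight+2e q e exceptional ⟩
      weight q + 2 * e            ∎
      where open ≤-Reasoning
    ... | no count₄≢0 with C₄.count>0⇒∃ (n≢0⇒n>0 count₄≢0)
    ...   | _ , s₄ , refl = begin
      2 * C₀.count q + C₄.count q ≤⟨ +-monoˡ-≤ (C₄.count q) (*-monoʳ-≤ 2 (C₀.count≤1 (λ _ _ → id) q)) ⟩
      2 + C₄.count q              ≤⟨ 2+count₄≤count₁ s₄ ⟩
      C₁.count q                  ≤⟨ ≤-trans (m≤m+n (C₁.count q) (C₃.count q)) (proj₁ (proj₂ (weight-bounds q))) ⟩
      weight q                    ≤⟨ m≤m+n (weight q) (2 * e) ⟩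
      weight q + 2 * e            ∎
      where open ≤-Reasoning

    ∑weight : ∑[ q < suc N ] weight q ≡ 2 * D + s₁ + 2 * s₂ + s₃
    ∑weight = begin
      ∑[ q < M ] (2 * CD.count q + C₁.count q + 2 * C₂.count q + C₃.count q)
        ≡⟨ ∑-distrib-+ M ⟩
      ∑[ q < M ] (2 * CD.count q + C₁.count q + 2 * C₂.count q) + ∑[ q < M ] C₃.count q
        ≡⟨ cong (_+ ∑[ q < M ] C₃.count q) (∑-distrib-+ M) ⟩
      ∑[ q < M ] (2 * CD.count q + C₁.count q) + ∑[ q < M ] (2 * C₂.count q) + ∑[ q < M ] C₃.count q
        ≡⟨ cong (λ x → x + ∑[ q < M ] (2 * C₂.count q) + ∑[ q < M ] C₃.count q) (∑-distrib-+ M) ⟩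
      ∑[ q < M ] (2 * CD.count q) + ∑[ q < M ] C₁.count q + ∑[ q < M ] (2 * C₂.count q) + ∑[ q < M ] C₃.count q
        ≡⟨ cong₂ (λ x y → x + ∑[ q < M ] C₁.count q + y + ∑[ q < M ] C₃.count q)
                 (∑-distribˡ-* 2 CD.count M) (∑-distribˡ-* 2 C₂.count M) ⟩
      2 * ∑[ q < M ] CD.count q + ∑[ q < M ] C₁.count q + 2 * ∑[ q < M ] C₂.count q + ∑[ q < M ] C₃.count q
        ≡⟨ sym (cong₂ _+_ (cong₂ _+_ (cong₂ _+_ (cong (2 *_) D≡) s₁≡) (cong (2 *_) s₂≡)) s₃≡) ⟩
      2 * D + s₁ + 2 * s₂ + s₃ ∎
      where
      open ≡-Reasoning
      M : ℕ
      M = suc N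
      D≡  : D ≡ ∑[ q < M ] CD.count q
      s₁≡ : s₁ ≡ ∑[ q < M ] C₁.count q
      s₂≡ : s₂ ≡ ∑[ q < M ] C₂.count q
      s₃≡ : s₃ ≡ ∑[ q < M ] C₃.count q
      D≡ = CD.n≡∑count M λ (_ , p≤N , _) → s≤s p≤N
      s₁≡ = C₁.n≡∑count M λ (_ , _ , _ , _ , (_ , a≤N , _)) → s≤s a≤N
      s₂≡ = C₂.n≡∑count M λ (_ , _ , _ , _ , _ , _ , (_ , a≤N , _)) → s≤s a≤N
      s₃≡ = C₃.n≡∑count M λ (_ , _ , _ , _ , _ , _ , _ , (_ , a≤N , _)) → s≤s a≤N

    sieve-inequality : (e : ℕ → ℕ) → (∀ q → e q ≡ 0 → S0Set N κ q → NonExceptional q) →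
      (2 * s₀ + s₄) ∸ (2 * D + s₁ + 2 * s₂ + s₃) ≤ 2 * ∑[ q < suc N ] e q
    sieve-inequality e exceptional = m≤n+o⇒m∸n≤o (2 * s₀ + s₄) (2 * D + s₁ + 2 * s₂ + s₃) (begin
      2 * s₀ + s₄
        ≡⟨ cong₂ (λ x y → 2 * x + y) s₀≡ s₄≡ ⟩
      2 * ∑[ q < M ] C₀.count q + ∑[ q < M ] C₄.count q
        ≡⟨ cong (_+ ∑[ q < M ] C₄.count q) (∑-distribˡ-* 2 C₀.count M) ⟨
      ∑[ q < M ] (2 * C₀.count q) + ∑[ q < M ] C₄.count q
        ≡⟨ ∑-distrib-+ M ⟨
      ∑[ q < M ] (2 * C₀.count q + C₄.count q)
        ≤⟨ ∑-mono-≤ M (λ q _ → pointwise q (e q) (exceptional q)) ⟩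
      ∑[ q < M ] (weight q + 2 * e q)
        ≡⟨ ∑-distrib-+ M ⟩
      ∑[ q < M ] weight q + ∑[ q < M ] (2 * e q)
        ≡⟨ cong₂ _+_ ∑weight (∑-distribˡ-* 2 e M) ⟩
      2 * D + s₁ + 2 * s₂ + s₃ + 2 * ∑[ q < M ] e q ∎)
      where
      open ≤-Reasoning
      M : ℕ
      M = suc N
      s₀≡ : s₀ ≡ ∑[ q < M ] C₀.count q
      s₄≡ : s₄ ≡ ∑[ q < M ] C₄.count q
      s₀≡ = C₀.n≡∑count M λ (_ , q≤N , _) → s≤s q≤N
      s₄≡ = C₄.n≡∑count M λ (_ , _ , _ , _ , _ , _ , _ , _ , (_ , a≤N , _)) → s≤s a≤N

record RootThreshold (N n D : ℕ) : Set where
  field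
    t           : ℕ
    1≤t         : 1 ≤ t
    t*t<N       : t * t < N
    1+t≤N       : suc t ≤ N
    N^n≤[1+t]^D : N ^ n ≤ suc t ^ D
    ℓ^D<N^n     : ∀ {ℓ} → ℓ ≤ t → ℓ ^ D < N ^ n

-- t + 1 is the least T with N^n ≤ T^D, i.e. T = ⌈N^(n/D)⌉; n/D ≤ 1/2 gives t² < N.
rootThreshold : ∀ {N n D} → 4 ≤ N → 1 ≤ n → n + n ≤ D → RootThreshold N n D
rootThreshold {D = zero} _ (s≤s _) ()
rootThreshold {N} {n} {D@(suc _)} 4≤N 1≤n n+n≤D =
  fromLeast (minimal (λ T → N ^ n ≤? T ^ D) (^-monoʳ-≤ N (≤-trans (m≤m+n n n) n+n≤D)))
  where
  instance
    N≢0 : NonZero N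
    N≢0 = >-nonZero (≤-trans (s≤s z≤n) 4≤N)

  fromLeast : (∃[ T ] T ≤ N × N ^ n ≤ T ^ D × (∀ {k} → k < T → ¬ N ^ n ≤ k ^ D)) → RootThreshold N n D
  fromLeast (zero , _ , N^n≤0 , _) = contradiction N^n≤0 (<⇒≱ (m^n>0 N n))
  fromLeast (suc zero , _ , N^n≤1^D , _) = contradiction 4≤1 λ { (s≤s ()) }
    where
    open ≤-Reasoning
    4≤1 : 4 ≤ 1
    4≤1 = begin
      4     ≤⟨ 4≤N ⟩
      N     ≡⟨ ^-identityʳ N ⟨
      N ^ 1 ≤⟨ ^-monoʳ-≤ N 1≤n ⟩
      N ^ n ≤⟨ N^n≤1^D ⟩
      1 ^ D ≡⟨ ^-zeroˡ D ⟩
      1     ∎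
  fromLeast (suc t@(suc _) , T≤N , N^n≤T^D , T-minimal) = record
    { t = t ; 1≤t = s≤s z≤n ; t*t<N = t*t<N ; 1+t≤N = T≤N ; N^n≤[1+t]^D = N^n≤T^D ; ℓ^D<N^n = ℓ^D<N^n }
    where
    open ≤-Reasoning
    ℓ^D<N^n : ∀ {ℓ} → ℓ ≤ t → ℓ ^ D < N ^ n
    ℓ^D<N^n ℓ≤t = ≰⇒> (T-minimal (s≤s ℓ≤t))
    t*t<N : t * t < N
    t*t<N = ^-cancelˡ-< D (begin-strict
      (t * t) ^ D   ≡⟨ ^-distribʳ-* t t D ⟩
      t ^ D * t ^ D <⟨ *-mono-< (ℓ^D<N^n ≤-refl) (ℓ^D<N^n ≤-refl) ⟩
      N ^ n * N ^ n ≡⟨ ^-distribˡ-+-* N n n ⟨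
      N ^ (n + n)   ≤⟨ ^-monoʳ-≤ N n+n≤D ⟩
      N ^ D         ∎)

module _ (κ σ : Real) (κ<σ : κ <ℝ σ) (σ<⅓ : σ <ℝℚ (+ 1 / 3)) {N : ℕ} (4≤N : 4 ≤ N)
  {D s₀ s₁ s₂ s₃ s₄ : ℕ}
  (hD : HasCard (D12Set N) D) (h₀ : HasCard (S0Set N κ) s₀)
  (h₁ : HasCard (S1Set N κ σ) s₁) (h₂ : HasCard (S2Set N κ σ) s₂)
  (h₃ : HasCard (S3Set N κ σ) s₃) (h₄ : HasCard (S4Set N κ σ) s₄) where

  open Sieve κ σ N 4≤N
  open Counting hD h₀ h₁ h₂ h₃ h₄

  private
    X : ℕ
    X = (2 * s₀ + s₄) ∸ (2 * D + s₁ + 2 * s₂ + s₃)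

    instance
      N≢0 : NonZero N
      N≢0 = >-nonZero 1≤N

  X<15*N : X < 15 * N
  X<15*N = begin-strict
    X                   ≤⟨ sieve-inequality (λ _ → 1) (λ _ ()) ⟩
    2 * ∑[ q < suc N ] 1 ≡⟨ cong (2 *_) (trans (∑-const 1 (suc N)) (*-identityʳ (suc N))) ⟩
    2 * suc N            ≡⟨ *-suc 2 N ⟩
    2 + 2 * N            ≤⟨ +-monoˡ-≤ (2 * N) 2≤N ⟩
    3 * N                <⟨ *-monoˡ-< N (m≤m+n 4 11) ⟩
    15 * N               ∎
    where open ≤-Reasoning

  X*N^r<15*N : ∀ r → L κ r → MulPowLt X N r (15 * N)
  X*N^r<15*N (mkℚ (+ zero) d₋₁ _) _ =
    subst (_< (15 * N) ^ suc d₋₁) (sym (*-identityʳ (X ^ suc d₋₁))) (^-monoˡ-< (suc d₋₁) X<15*N)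
  X*N^r<15*N (mkℚ -[1+ m ] d₋₁ _) _ =
    <-≤-trans (^-monoˡ-< (suc d₋₁) X<15*N) (m≤m*n _ (N ^ suc m) {{m^n≢0 N (suc m)}})
  X*N^r<15*N r@(mkℚ (+ n@(suc _)) d₋₁ _) r<κ = begin-strict
    X ^ d * N ^ n        ≤⟨ *-monoʳ-≤ (X ^ d) N^n≤[1+t]^D ⟩
    X ^ d * suc t ^ d    ≡⟨ ^-distribʳ-* X (suc t) d ⟨
    (X * suc t) ^ d      ≤⟨ ^-monoˡ-≤ d X*[1+t]≤14*N ⟩
    (14 * N) ^ d         <⟨ ^-monoˡ-< d (*-monoˡ-< N (n<1+n 14)) ⟩
    (15 * N) ^ d         ∎
    where
    open ≤-Reasoning
    d : ℕ
    d = suc d₋₁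

    n+n≤d : n + n ≤ d
    n+n≤d with <ℝ-<ℝℚ⇒L< κ σ κ<σ σ<⅓ r<κ
    ... | ℚ.*<* r<⅓ = begin
      n + n ≤⟨ +-monoʳ-≤ n (m≤m+n n (n + 0)) ⟩
      3 * n ≡⟨ *-comm 3 n ⟩
      n * 3 <⟨ ℤ+-*-<⇒< {n} {3} {1} {d} r<⅓ ⟩
      1 * d ≡⟨ *-identityˡ d ⟩
      d     ∎

    open RootThreshold (rootThreshold 4≤N (s≤s z≤n) n+n≤d)

    nonExceptional : ∀ q → exceptionalWeight N (suc t) q ≡ 0 → S0Set N κ q → NonExceptional q
    nonExceptional q e≡0 (pq , q≤N , _) = q∤N , λ {ℓ} pℓ ℓ≮N^κ ℓ*ℓ∣a →
      proj₂ exceptional (≰⇒> λ ℓ≤t → ℓ≮N^κ (r , r<κ , ℓ^D<N^n ℓ≤t)) (ℓ≤N pℓ ℓ*ℓ∣a) ℓ*ℓ∣a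
      where
      exceptional : ¬ (Prime q × q ∣ N) × (∀ {ℓ} → suc t ≤ ℓ → ℓ ≤ N → ¬ ℓ * ℓ ∣ N ∸ q)
      exceptional = exceptionalWeight≡0⇒ e≡0
      q∤N : ¬ q ∣ N
      q∤N q∣N = proj₁ exceptional (pq , q∣N)
      ℓ≤N : ∀ {ℓ} → Prime ℓ → ℓ * ℓ ∣ N ∸ q → ℓ ≤ N
      ℓ≤N {ℓ} pℓ ℓ*ℓ∣a = begin
        ℓ     ≤⟨ m≤m*n ℓ ℓ {{prime⇒nonZero pℓ}} ⟩
        ℓ * ℓ ≤⟨ ∣⇒≤ {{>-nonZero (m<n⇒0<n∸m (≤∧≢⇒< q≤N λ q≡N → q∤N (subst (q ∣_) q≡N ∣-refl)))}} ℓ*ℓ∣a ⟩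
        N ∸ q ≤⟨ m∸n≤m N q ⟩
        N     ∎

    X*[1+t]≤14*N : X * suc t ≤ 14 * N
    X*[1+t]≤14*N = begin
      X * suc t                                         ≤⟨ *-monoˡ-≤ (suc t) (sieve-inequality (exceptionalWeight N (suc t)) nonExceptional) ⟩
      2 * ∑[ q < suc N ] exceptionalWeight N (suc t) q * suc t ≡⟨ *-assoc 2 (∑[ q < suc N ] exceptionalWeight N (suc t) q) (suc t) ⟩
      2 * (∑[ q < suc N ] exceptionalWeight N (suc t) q * suc t) ≤⟨ *-monoʳ-≤ 2 (∑exceptionalWeight*T≤7N 1≤t t*t<N 1+t≤N) ⟩
      2 * (7 * N)                                       ≡⟨ *-assoc 2 7 N ⟨
      14 * N                                            ∎

lemma9p1 : (κ σ : Real) → 0ℚ <ℚℝ κ → κ <ℝ σ → σ <ℝℚ (+ 1 / 3) →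
    ∃ λ (C : ℕ) → ∀ (N : ℕ) → 2 ∣ N → 4 ≤ N →
      ∀ (D s₀ s₁ s₂ s₃ s₄ : ℕ) →
      HasCard (D12Set N) D → HasCard (S0Set N κ) s₀ →
      HasCard (S1Set N κ σ) s₁ → HasCard (S2Set N κ σ) s₂ →
      HasCard (S3Set N κ σ) s₃ → HasCard (S4Set N κ σ) s₄ →
      LeMulPow1- ((2 * s₀ + s₄) ∸ (2 * D + s₁ + 2 * s₂ + s₃)) C N κ
lemma9p1 κ σ _ κ<σ σ<⅓ = 15 , λ N _ 4≤N _ _ _ _ _ _ hD h₀ h₁ h₂ h₃ h₄ →
  inj₂ (X*N^r<15*N κ σ κ<σ σ<⅓ 4≤N hD h₀ h₁ h₂ h₃ h₄)
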